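{- Let $G$ be a unicyclic graph on $n\geq 5$ vertices that contains $C_4$ as an induced subgraph (so its unique cycle is this $4$-cycle). Consider the degrees in $G$ of the four vertices of this cycle. Then: (1) if at most one vertex of the cycle has degree $2$, then $\operatorname{Z}(\overline{G})=n-4$; (2) if exactly two vertices of the cycle have degree $2$, then (a) if these two vertices are adjacent, $\operatorname{Z}(\overline{G})=n-4$, and (b) if these two vertices are not adjacent, $\operatorname{Z}(\overline{G})=n-3$; (3) if exactly three vertices of the cycle have degree $2$, then $\operatorname{Z}(\overline{G})=n-3$.
   Context: All graphs are finite, simple and undirected. A unicyclic graph is a connected graph containing exactly one cycle. $\overline{G}$ denotes the complement of $G$ (same vertex set; distinct vertices adjacent iff not adjacent in $G$). Zero forcing: given an initial set $B\subseteq V(G)$ of blue vertices (all others white), a blue vertex with exactly one white neighbor may turn that neighbor blue; $B$ is a zero forcing set if repeated application makes all vertices blue. $\operatorname{Z}(G)$ is the minimum size of a zero forcing set of $G$. -}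

module Defs where

open import Data.Nat using (ℕ; zero; suc; _+_; _≤_; _≟_)
open import Data.Bool using (Bool; true; false; not; if_then_else_)
open import Data.Fin using (Fin; zero; suc; inject₁; fromℕ)
import Data.Fin as F
open import Data.Fin.Subset using (Subset; _∈_; ∣_∣)
open import Data.List using (List; []; _∷_; map; filter; length)
open import Data.Nat.ListAction using (sum)
open import Data.List.Base using (allFin)
open import Data.Product using (Σ; ∃; _×_; _,_)
open import Data.Sum using (_⊎_)
open import Relation.Binary.PropositionalEquality using (_≡_; _≢_; refl; cong)
open import Relation.Nullary using (¬_; yes; no)
open import Relation.Nullary.Decidable using (⌊_⌋)
open import Function.Definitions using (Injective)

record Graph (n : ℕ) : Set where
  field
    adj   : Fin n → Fin n → Bool
    sym   : ∀ u v → adj u v ≡ adj v u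
    irr   : ∀ v → adj v v ≡ false
open Graph public

Adj : ∀ {n} → Graph n → Fin n → Fin n → Set
Adj G u v = adj G u v ≡ true

private
  cadj : ∀ {n} → Graph n → Fin n → Fin n → Bool
  cadj G u v = if ⌊ u F.≟ v ⌋ then false else not (adj G u v)

  cdec-sym : ∀ {n} (u v : Fin n) → ⌊ u F.≟ v ⌋ ≡ ⌊ v F.≟ u ⌋
  cdec-sym u v with u F.≟ v | v F.≟ u
  ... | yes _ | yes _ = refl
  ... | no _  | no _  = refl
  ... | yes p | no q  = Data.Empty.⊥-elim (q (Relation.Binary.PropositionalEquality.sym p))
    where import Data.Empty
  ... | no p  | yes q = Data.Empty.⊥-elim (p (Relation.Binary.PropositionalEquality.sym q))
    where import Data.Empty

  csym : ∀ {n} (G : Graph n) u v → cadj G u v ≡ cadj G v u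
  csym G u v rewrite cdec-sym u v | Graph.sym G u v = refl

  cirr : ∀ {n} (G : Graph n) v → cadj G v v ≡ false
  cirr G v with v F.≟ v
  ... | yes _ = refl
  ... | no p = Data.Empty.⊥-elim (p refl)
    where import Data.Empty

complement : ∀ {n} → Graph n → Graph n
complement G = record { adj = cadj G ; sym = csym G ; irr = cirr G }

deg : ∀ {n} → Graph n → Fin n → ℕ
deg {n} G v = sum (map (λ u → if adj G v u then 1 else 0) (allFin n))

data Walk {n} (G : Graph n) : Fin n → Fin n → Set where
  here : ∀ {u} → Walk G u u
  step : ∀ {u w v} → Adj G u w → Walk G w v → Walk G u v

Connected : ∀ {n} → Graph n → Set
Connected {n} G = (u v : Fin n) → Walk G u v

record Cycle {n} (G : Graph n) : Set where
  field
    len    : ℕ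
    vtx    : Fin (3 + len) → Fin n
    inj    : Injective _≡_ _≡_ vtx
    consec : (i : Fin (2 + len)) → Adj G (vtx (inject₁ i)) (vtx (suc i))
    close  : Adj G (vtx (fromℕ (2 + len))) (vtx zero)
open Cycle public

CycleStep : ∀ {n} {G : Graph n} → Cycle G → Fin n → Fin n → Set
CycleStep C u v =
  (Σ (Fin (2 + len C)) λ i → vtx C (inject₁ i) ≡ u × vtx C (suc i) ≡ v)
  ⊎ (vtx C (fromℕ (2 + len C)) ≡ u × vtx C zero ≡ v)

UsesEdge : ∀ {n} {G : Graph n} → Cycle G → Fin n → Fin n → Set
UsesEdge C u v = CycleStep C u v ⊎ CycleStep C v u

-- Unicyclic: connected, has a cycle, and any two cycles have the same edge set
-- (i.e. exactly one cycle, cycles being considered as subgraphs).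
Unicyclic : ∀ {n} → Graph n → Set
Unicyclic {n} G =
  Connected G × Cycle G ×
  ((C D : Cycle G) (u v : Fin n) → UsesEdge C u v → UsesEdge D u v)

InducedC4 : ∀ {n} → Graph n → Fin n → Fin n → Fin n → Fin n → Set
InducedC4 G a b c d =
  a ≢ b × a ≢ c × a ≢ d × b ≢ c × b ≢ d × c ≢ d ×
  Adj G a b × Adj G b c × Adj G c d × Adj G d a ×
  adj G a c ≡ false × adj G b d ≡ false

numDeg2 : ∀ {n} → Graph n → Fin n → Fin n → Fin n → Fin n → ℕ
numDeg2 G a b c d = length (filter (λ x → deg G x ≟ 2) (a ∷ b ∷ c ∷ d ∷ []))

data Blue {n} (G : Graph n) (B : Subset n) : Fin n → Set where
  init  : ∀ {v} → v ∈ B → Blue G B v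
  force : ∀ {u v} → Blue G B u → Adj G u v →
          (∀ w → Adj G u w → w ≢ v → Blue G B w) → Blue G B v

IsZeroForcingSet : ∀ {n} → Graph n → Subset n → Set
IsZeroForcingSet {n} G B = (v : Fin n) → Blue G B v

ZeroForcingNumberIs : ∀ {n} → Graph n → ℕ → Set
ZeroForcingNumberIs {n} G k =
  (Σ (Subset n) λ B → IsZeroForcingSet G B × ∣ B ∣ ≡ k) ×
  ((B : Subset n) → IsZeroForcingSet G B → k ≤ ∣ B ∣)

module Submission where

-- A fort (a nonempty S such that no vertex outside S has exactly one neighbour
-- in S) can never be forced, so the white set W of a zero forcing set of Ḡ is not a fort: some
-- x ∉ W has a unique Ḡ-neighbour v ∈ W, i.e. x is G-adjacent to all of W − v. Repeating this
-- with W − v gives y ≠ x, and x, y have |W| − 2 common G-neighbours. A unicyclic G contains no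
-- K₂,₃, so |W| ≤ 4. If |W| = 4, the two common neighbours g, h make x g y h a 4-cycle, which
-- must be the induced square; when every edge of the square has an endpoint of degree 2, g and
-- h both have the neighbours x, y only, so {g, h} is a fort of Ḡ and |W| ≤ 3.
-- Upper bounds. If a corner p has degree ≥ 3 and p′ is a neighbour of p off the square, then
-- in Ḡ the corner p forces the opposite corner r, r forces p′, and s, once blue, forces q; so
-- V − {p′, q, r} is zero forcing. If the adjacent corner q also has a neighbour q′ off the
-- square, q′ forces s, so V − {p′, q, r, s} is zero forcing.
-- The four cases of the theorem only decide whether some edge of the square has both
-- endpoints of degree ≥ 3.

open import Defs hiding (sym)

-- An anonymous module keeps the import of Data.Fin.Subset._∈_ away from the list membership
-- used in the statement of theorem3p9.
module _ where

  open import Data.Nat using (ℕ; zero; suc; _+_; _∸_; _≤_; _<_; z≤n; s≤s; s≤s⁻¹)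
  open import Data.Nat.Properties
    using (≤-trans; suc-injective; ∸-+-assoc; ∸-monoʳ-≤; m∸[m∸n]≡n; ≮⇒≥; module ≤-Reasoning)
  open import Data.Nat.ListAction using (sum)
  open import Data.Bool using (Bool; true; false; if_then_else_)
  import Data.Bool as Bool
  open import Data.Bool.Properties using (¬-not)
  open import Data.Fin using (Fin; zero; suc; _≟_)
  open import Data.Fin.Subset
    using (Subset; inside; outside; _∈_; _∉_; _⊆_; _-_; ∣_∣; ⁅_⁆; Nonempty; Empty; ⊤; ∁)
  open import Data.Fin.Subset.Properties
    using (_∈?_; ∈⊤; ∣⊤∣≡n; ∣∁p∣≡n∸∣p∣; ∣p∣≤n; x∈∁p⇒x∉p; p─⊥≡p; p─q⊆p; Empty-unique; ∣⊥∣≡0; nonempty?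
          ; x∈p∧x≢y⇒x∈p-y)
  open import Data.List using ([]; _∷_; map; allFin; tabulate; length; filter)
  open import Data.List.Properties using (map-tabulate)
  open import Data.Vec using (Vec; []; _∷_; here; there)
  import Data.Vec as Vec
  open import Data.Vec.Relation.Unary.Unique.Propositional using (Unique)
  open import Data.Vec.Relation.Unary.Unique.Propositional.Properties using (lookup-injective)
  open import Data.Vec.Relation.Unary.All using ([]; _∷_)
  open import Data.Vec.Relation.Unary.AllPairs using ([]; _∷_)
  open import Data.Vec.Properties using (lookup∘tabulate; []=⇒lookup; lookup⇒[]=)
  open import Data.Product using (Σ; ∃; ∃₂; _×_; _,_; proj₁; proj₂)
  open import Data.Sum using (_⊎_; inj₁; inj₂; [_,_])
  open import Data.Empty using (⊥; ⊥-elim)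
  open import Function using (id; _∘_)
  open import Relation.Unary using (Decidable)
  open import Relation.Nullary using (¬_; Dec; does; yes; no; ¬?; _×-dec_; contradiction)
  open import Data.Fin.Properties using (any?)
  open import Relation.Binary.PropositionalEquality
    using (_≡_; _≢_; refl; sym; ≢-sym; trans; cong; subst; module ≡-Reasoning)

  private
    variable
      n : ℕ

  -- Subsets of Fin n

  x∉p-x : ∀ {x : Fin n} (p : Subset n) → x ∉ p - x
  x∉p-x {x = zero}  (_ ∷ p) ()
  x∉p-x {x = suc x} (_ ∷ p) (there x∈p-x) = x∉p-x p x∈p-x

  x∈p-y⁻ : ∀ {x y : Fin n} (p : Subset n) → x ∈ p - y → x ∈ p × x ≢ y
  x∈p-y⁻ {y = y} p x∈p-y = p─q⊆p p ⁅ y ⁆ x∈p-y , λ { refl → x∉p-x p x∈p-y }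

  ∣p∣≡1+∣p-x∣ : ∀ {x : Fin n} {p : Subset n} → x ∈ p → ∣ p ∣ ≡ suc ∣ p - x ∣
  ∣p∣≡1+∣p-x∣ {x = zero}  {inside  ∷ p} here      = cong suc (sym (cong ∣_∣ (p─⊥≡p p)))
  ∣p∣≡1+∣p-x∣ {x = suc x} {inside  ∷ p} (there m) = cong suc (∣p∣≡1+∣p-x∣ m)
  ∣p∣≡1+∣p-x∣ {x = suc x} {outside ∷ p} (there m) = ∣p∣≡1+∣p-x∣ m

  ∣p∣≡2+∣p-x-y∣ : ∀ {x y : Fin n} {p : Subset n} → x ∈ p → y ∈ p → x ≢ y → ∣ p ∣ ≡ 2 + ∣ p - x - y ∣
  ∣p∣≡2+∣p-x-y∣ x∈p y∈p x≢y = trans (∣p∣≡1+∣p-x∣ x∈p) (cong suc (∣p∣≡1+∣p-x∣ (x∈p∧x≢y⇒x∈p-y y∈p (≢-sym x≢y))))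

  Empty⇒∣p∣≡0 : {p : Subset n} → Empty p → ∣ p ∣ ≡ 0
  Empty⇒∣p∣≡0 {n} p-empty = trans (cong ∣_∣ (Empty-unique p-empty)) (∣⊥∣≡0 n)

  0<∣p∣⇒Nonempty : {p : Subset n} → 0 < ∣ p ∣ → Nonempty p
  0<∣p∣⇒Nonempty {p = p} 0<∣p∣ with nonempty? p
  ... | yes p-nonempty = p-nonempty
  ... | no  p-empty    with () ← subst (0 <_) (Empty⇒∣p∣≡0 p-empty) 0<∣p∣

  two-elements : {p : Subset n} → 2 ≤ ∣ p ∣ →
                 ∃₂ λ x y → x ∈ p × y ∈ p × x ≢ y × ∣ p ∣ ≡ 2 + ∣ p - x - y ∣
  two-elements {p = p} 2≤∣p∣
    with x , x∈p   ← 0<∣p∣⇒Nonempty (≤-trans (s≤s z≤n) 2≤∣p∣)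
    with y , y∈p-x ← 0<∣p∣⇒Nonempty (s≤s⁻¹ (subst (2 ≤_) (∣p∣≡1+∣p-x∣ x∈p) 2≤∣p∣))
    with y∈p , y≢x ← x∈p-y⁻ p y∈p-x
    = x , y , x∈p , y∈p , ≢-sym y≢x , ∣p∣≡2+∣p-x-y∣ x∈p y∈p (≢-sym y≢x)

  three-elements : {p : Subset n} → 3 ≤ ∣ p ∣ →
                   ∃₂ λ x y → ∃ λ z → x ∈ p × y ∈ p × z ∈ p × x ≢ y × x ≢ z × y ≢ z
  three-elements {p = p} 3≤∣p∣
    with x , y , x∈p , y∈p , x≢y , ∣p∣≡2+∣p-x-y∣ ← two-elements (≤-trans (s≤s (s≤s z≤n)) 3≤∣p∣)
    with z , z∈p-x-y ← 0<∣p∣⇒Nonempty (s≤s⁻¹ (s≤s⁻¹ (subst (3 ≤_) ∣p∣≡2+∣p-x-y∣ 3≤∣p∣)))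
    with z∈p-x , z≢y ← x∈p-y⁻ _ z∈p-x-y
    with z∈p , z≢x ← x∈p-y⁻ p z∈p-x
    = x , y , z , x∈p , y∈p , z∈p , x≢y , ≢-sym z≢x , ≢-sym z≢y

  Empty[p-x-y]⇒x⊎y : ∀ {x y w : Fin n} {p : Subset n} → Empty (p - x - y) → w ∈ p → w ≡ x ⊎ w ≡ y
  Empty[p-x-y]⇒x⊎y {x = x} {y} {w} p-x-y-empty w∈p with w ≟ x | w ≟ y
  ... | yes w≡x | _       = inj₁ w≡x
  ... | no _    | yes w≡y = inj₂ w≡y
  ... | no w≢x  | no w≢y  = ⊥-elim (p-x-y-empty (w , x∈p∧x≢y⇒x∈p-y (x∈p∧x≢y⇒x∈p-y w∈p w≢x) w≢y))

  ∣p-x∣≡∣p∣∸1 : ∀ {x : Fin n} {p : Subset n} → x ∈ p → ∣ p - x ∣ ≡ ∣ p ∣ ∸ 1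
  ∣p-x∣≡∣p∣∸1 x∈p = cong (_∸ 1) (sym (∣p∣≡1+∣p-x∣ x∈p))

  ∣⊤-x-y-z∣≡n∸3 : ∀ {x y z : Fin n} → x ≢ y → x ≢ z → y ≢ z → ∣ ⊤ - x - y - z ∣ ≡ n ∸ 3
  ∣⊤-x-y-z∣≡n∸3 {n} {x} {y} {z} x≢y x≢z y≢z = begin
    ∣ ⊤ - x - y - z ∣      ≡⟨ ∣p-x∣≡∣p∣∸1 (x∈p∧x≢y⇒x∈p-y (x∈p∧x≢y⇒x∈p-y ∈⊤ (≢-sym x≢z)) (≢-sym y≢z)) ⟩
    ∣ ⊤ - x - y ∣ ∸ 1      ≡⟨ cong (_∸ 1) (∣p-x∣≡∣p∣∸1 (x∈p∧x≢y⇒x∈p-y ∈⊤ (≢-sym x≢y))) ⟩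
    ∣ ⊤ - x ∣ ∸ 1 ∸ 1      ≡⟨ cong (λ k → k ∸ 1 ∸ 1) (∣p-x∣≡∣p∣∸1 {x = x} {p = ⊤} ∈⊤) ⟩
    ∣ ⊤ {n} ∣ ∸ 1 ∸ 1 ∸ 1 ≡⟨ cong (λ k → k ∸ 1 ∸ 1 ∸ 1) (∣⊤∣≡n n) ⟩
    n ∸ 1 ∸ 1 ∸ 1          ≡⟨ trans (∸-+-assoc (n ∸ 1) 1 1) (∸-+-assoc n 1 2) ⟩
    n ∸ 3                  ∎
    where open ≡-Reasoning

  ∣⊤-w-x-y-z∣≡n∸4 : ∀ {w x y z : Fin n} → w ≢ x → w ≢ y → w ≢ z → x ≢ y → x ≢ z → y ≢ z →
                    ∣ ⊤ - w - x - y - z ∣ ≡ n ∸ 4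
  ∣⊤-w-x-y-z∣≡n∸4 {n} {w} {x} {y} {z} w≢x w≢y w≢z x≢y x≢z y≢z = begin
    ∣ ⊤ - w - x - y - z ∣  ≡⟨ ∣p-x∣≡∣p∣∸1 z∈⊤-w-x-y ⟩
    ∣ ⊤ - w - x - y ∣ ∸ 1  ≡⟨ cong (_∸ 1) (∣⊤-x-y-z∣≡n∸3 w≢x w≢y x≢y) ⟩
    n ∸ 3 ∸ 1              ≡⟨ ∸-+-assoc n 3 1 ⟩
    n ∸ 4                  ∎
    where
    open ≡-Reasoning
    z∈⊤-w-x-y = x∈p∧x≢y⇒x∈p-y (x∈p∧x≢y⇒x∈p-y (x∈p∧x≢y⇒x∈p-y ∈⊤ (≢-sym w≢z)) (≢-sym x≢z)) (≢-sym y≢z)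

  ∣∁p∣≤k⇒n∸k≤∣p∣ : ∀ {k} (p : Subset n) → ∣ ∁ p ∣ ≤ k → n ∸ k ≤ ∣ p ∣
  ∣∁p∣≤k⇒n∸k≤∣p∣ {n} {k} p ∣∁p∣≤k = begin
    n ∸ k            ≤⟨ ∸-monoʳ-≤ n (subst (_≤ k) (∣∁p∣≡n∸∣p∣ p) ∣∁p∣≤k) ⟩
    n ∸ (n ∸ ∣ p ∣)  ≡⟨ m∸[m∸n]≡n (∣p∣≤n p) ⟩
    ∣ p ∣            ∎
    where open ≤-Reasoning

  sum-indicator≡∣tabulate∣ : (f : Fin n → Bool) →
                             sum (map (λ u → if f u then 1 else 0) (allFin n)) ≡ ∣ Vec.tabulate f ∣
  sum-indicator≡∣tabulate∣ {zero}  f = refl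
  sum-indicator≡∣tabulate∣ {suc n} f = begin
    indicator zero + sum (map indicator (tabulate suc))
      ≡⟨ cong (λ xs → indicator zero + sum xs)
              (trans (map-tabulate suc indicator) (sym (map-tabulate id (indicator ∘ suc)))) ⟩
    indicator zero + sum (map (indicator ∘ suc) (allFin n))
      ≡⟨ cong (indicator zero +_) (sum-indicator≡∣tabulate∣ (f ∘ suc)) ⟩
    indicator zero + ∣ Vec.tabulate (f ∘ suc) ∣
      ≡⟨ sym (∣∷∣ (f zero) (Vec.tabulate (f ∘ suc))) ⟩
    ∣ Vec.tabulate f ∣ ∎
    where
    open ≡-Reasoning
    indicator : Fin (suc n) → ℕ
    indicator u = if f u then 1 else 0
    ∣∷∣ : ∀ b (p : Subset n) → ∣ b ∷ p ∣ ≡ (if b then 1 else 0) + ∣ p ∣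
    ∣∷∣ inside  p = refl
    ∣∷∣ outside p = refl

  -- Neighbourhoods and degrees

  module _ (G : Graph n) where

    adj⇒≢ : ∀ {u v} → Adj G u v → u ≢ v
    adj⇒≢ {u} uv refl with () ← trans (sym uv) (irr G u)

    adj-sym : ∀ {u v} → Adj G u v → Adj G v u
    adj-sym {u} {v} uv = trans (Graph.sym G v u) uv

    nonadj⇒≢ : ∀ {u w z} → adj G u w ≡ false → Adj G u z → w ≢ z
    nonadj⇒≢ ¬uw uz refl with () ← trans (sym uz) ¬uw

    neighbourhood : Fin n → Subset n
    neighbourhood v = Vec.tabulate (adj G v)

    ∈-neighbourhood⁺ : ∀ {v u} → Adj G v u → u ∈ neighbourhood v
    ∈-neighbourhood⁺ {v} {u} vu = lookup⇒[]= u _ (trans (lookup∘tabulate (adj G v) u) vu)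

    ∈-neighbourhood⁻ : ∀ {v u} → u ∈ neighbourhood v → Adj G v u
    ∈-neighbourhood⁻ {v} {u} u∈N = trans (sym (lookup∘tabulate (adj G v) u)) ([]=⇒lookup u∈N)

    deg≡∣neighbourhood∣ : ∀ v → deg G v ≡ ∣ neighbourhood v ∣
    deg≡∣neighbourhood∣ v = sum-indicator≡∣tabulate∣ (adj G v)

    module _ {v x y} (vx : Adj G v x) (vy : Adj G v y) (x≢y : x ≢ y) where

      deg≡2+∣neighbourhood-x-y∣ : deg G v ≡ 2 + ∣ neighbourhood v - x - y ∣
      deg≡2+∣neighbourhood-x-y∣ =
        trans (deg≡∣neighbourhood∣ v) (∣p∣≡2+∣p-x-y∣ (∈-neighbourhood⁺ vx) (∈-neighbourhood⁺ vy) x≢y)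

      third-neighbour⇒deg≢2 : ∀ {w} → Adj G v w → w ≢ x → w ≢ y → deg G v ≢ 2
      third-neighbour⇒deg≢2 vw w≢x w≢y deg≡2
        with () ← trans (suc-injective (suc-injective (trans (sym deg≡2) deg≡2+∣neighbourhood-x-y∣)))
                        (∣p∣≡1+∣p-x∣ (x∈p∧x≢y⇒x∈p-y (x∈p∧x≢y⇒x∈p-y (∈-neighbourhood⁺ vw) w≢x) w≢y))

      deg≢2⇒third-neighbour : deg G v ≢ 2 → ∃ λ w → Adj G v w × w ≢ x × w ≢ y
      deg≢2⇒third-neighbour deg≢2 with nonempty? (neighbourhood v - x - y)
      ... | yes (w , w∈N-x-y) =
        let w∈N-x , w≢y = x∈p-y⁻ _ w∈N-x-y
            w∈N , w≢x   = x∈p-y⁻ _ w∈N-x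
        in  w , ∈-neighbourhood⁻ w∈N , w≢x , w≢y
      ... | no N-x-y-empty =
        contradiction (trans deg≡2+∣neighbourhood-x-y∣ (cong (2 +_) (Empty⇒∣p∣≡0 N-x-y-empty))) deg≢2

      deg≡2⇒neighbour-is-one-of : deg G v ≡ 2 → ∀ {w} → Adj G v w → w ≡ x ⊎ w ≡ y
      deg≡2⇒neighbour-is-one-of deg≡2 {w} vw with w ≟ x | w ≟ y
      ... | yes w≡x | _       = inj₁ w≡x
      ... | no _    | yes w≡y = inj₂ w≡y
      ... | no w≢x  | no w≢y  = contradiction deg≡2 (third-neighbour⇒deg≢2 vw w≢x w≢y)

  -- Complements and forts

  module _ (G : Graph n) {u v : Fin n} where

    complement-adj⁻ : Adj (complement G) u v → u ≢ v × adj G u v ≡ false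
    complement-adj⁻ uv with u ≟ v | adj G u v
    ... | no u≢v | false = u≢v , refl

    complement-adj⁺ : u ≢ v → adj G u v ≡ false → Adj (complement G) u v
    complement-adj⁺ u≢v ¬uv with u ≟ v
    ... | yes u≡v = contradiction u≡v u≢v
    ... | no _    rewrite ¬uv = refl

    ¬complement-adj⇒adj : u ≢ v → ¬ Adj (complement G) u v → Adj G u v
    ¬complement-adj⇒adj u≢v ¬uv = ¬-not (¬uv ∘ complement-adj⁺ u≢v)

  module _ (G : Graph n) where

    Fort : Subset n → Set
    Fort S = ∀ {x v} → x ∉ S → v ∈ S → Adj G x v → ∃ λ w → w ∈ S × w ≢ v × Adj G x w

    fort-excludes-blue : ∀ {S B v} → Fort S → S ⊆ ∁ B → Blue G B v → v ∉ S
    fort-excludes-blue fort S⊆∁B (init v∈B) v∈S = x∈∁p⇒x∉p (S⊆∁B v∈S) v∈B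
    fort-excludes-blue fort S⊆∁B (force blue-u uv others) v∈S =
      let w , w∈S , w≢v , uw = fort (fort-excludes-blue fort S⊆∁B blue-u) v∈S uv
      in  fort-excludes-blue fort S⊆∁B (others w uw w≢v) w∈S

    fort-meets-zero-forcing-set : ∀ {S B} → IsZeroForcingSet G B → Fort S → Nonempty S → ¬ S ⊆ ∁ B
    fort-meets-zero-forcing-set zfs fort (v , v∈S) S⊆∁B = fort-excludes-blue fort S⊆∁B (zfs v) v∈S

    LoneNeighbour : Subset n → Fin n → Fin n → Set
    LoneNeighbour S x v = x ∉ S × v ∈ S × Adj G x v × ¬ (∃ λ w → w ∈ S × w ≢ v × Adj G x w)

    private
      adj? : ∀ x v → Dec (Adj G x v)
      adj? x v = adj G x v Bool.≟ true

      other? : ∀ S x v → Dec (∃ λ w → w ∈ S × w ≢ v × Adj G x w)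
      other? S x v = any? (λ w → w ∈? S ×-dec ¬? (w ≟ v) ×-dec adj? x w)

      lone? : ∀ S x v → Dec (LoneNeighbour S x v)
      lone? S x v = ¬? (x ∈? S) ×-dec v ∈? S ×-dec adj? x v ×-dec ¬? (other? S x v)

    fort⊎lone-neighbour : ∀ S → Fort S ⊎ ∃₂ (LoneNeighbour S)
    fort⊎lone-neighbour S with any? (λ x → any? (λ v → lone? S x v))
    ... | yes (x , v , lone) = inj₂ (x , v , lone)
    ... | no ¬lone           = inj₁ fort
      where
      fort : Fort S
      fort {x} {v} x∉S v∈S xv with other? S x v
      ... | yes other = other
      ... | no ¬other = contradiction (x , v , x∉S , v∈S , xv , ¬other) ¬lone

    zero-forcing⇒lone-neighbour : ∀ {B W} → IsZeroForcingSet G B → W ⊆ ∁ B → Nonempty W →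
                                  ∃₂ (LoneNeighbour W)
    zero-forcing⇒lone-neighbour {W = W} zfs W⊆∁B W-nonempty with fort⊎lone-neighbour W
    ... | inj₁ fort = ⊥-elim (fort-meets-zero-forcing-set zfs fort W-nonempty W⊆∁B)
    ... | inj₂ lone = lone

  lone-neighbour-in-complement : ∀ (G : Graph n) {W x v} → LoneNeighbour (complement G) W x v →
                                 ∀ {w} → w ∈ W - v → Adj G x w
  lone-neighbour-in-complement G (x∉W , _ , _ , no-other) w∈W-v =
    let w∈W , w≢v = x∈p-y⁻ _ w∈W-v
    in  ¬complement-adj⇒adj G (λ { refl → x∉W w∈W }) (λ xw → no-other (_ , w∈W , w≢v , xw))

  non-adjacency-transfers : ∀ (G : Graph n) {g h z} → (∀ {w} → Adj G h w → Adj G g w) →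
                            adj G z g ≡ false → adj G z h ≡ false
  non-adjacency-transfers G h⊆g ¬zg = ¬-not λ zh → nonadj⇒≢ G ¬zg (adj-sym G (h⊆g (adj-sym G zh))) refl

  twins-fort : ∀ (G : Graph n) {g h S} → (∀ {w} → Adj G g w → Adj G h w) → (∀ {w} → Adj G h w → Adj G g w) →
               (∀ {w} → w ∈ S → w ≡ g ⊎ w ≡ h) → g ∈ S → h ∈ S → g ≢ h → Fort (complement G) S
  twins-fort G g⊆h h⊆g S⊆gh g∈S h∈S g≢h {z} z∉S v∈S zv with S⊆gh v∈S | complement-adj⁻ G zv
  ... | inj₁ refl | _ , ¬zg =
    _ , h∈S , ≢-sym g≢h , complement-adj⁺ G (λ { refl → z∉S h∈S }) (non-adjacency-transfers G h⊆g ¬zg)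
  ... | inj₂ refl | _ , ¬zh =
    _ , g∈S , g≢h , complement-adj⁺ G (λ { refl → z∉S g∈S }) (non-adjacency-transfers G g⊆h ¬zh)

  record CommonNeighbours (G : Graph n) (B : Subset n) : Set where
    field
      x y f           : Fin n
      core            : Subset n
      x≢y             : x ≢ y
      xf              : Adj G x f
      x-core          : ∀ {w} → w ∈ core → Adj G x w
      y-core          : ∀ {w} → w ∈ core → Adj G y w
      core≢f          : ∀ {w} → w ∈ core → w ≢ f
      core⊆∁B         : core ⊆ ∁ B
      ∣∁B∣≡2+∣core∣   : ∣ ∁ B ∣ ≡ 2 + ∣ core ∣

  common-neighbours : ∀ (G : Graph n) {B} → IsZeroForcingSet (complement G) B → 2 ≤ ∣ ∁ B ∣ →
                      CommonNeighbours G B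
  common-neighbours G {B} zfs 2≤∣∁B∣
    with x , v , x-lone ← zero-forcing⇒lone-neighbour (complement G) zfs (λ w∈ → w∈)
                            (0<∣p∣⇒Nonempty (≤-trans (s≤s z≤n) 2≤∣∁B∣))
    with v∈∁B ← proj₁ (proj₂ x-lone)
    with y , f , y-lone ← zero-forcing⇒lone-neighbour (complement G) zfs (p─q⊆p (∁ B) ⁅ v ⁆)
                            (0<∣p∣⇒Nonempty (s≤s⁻¹ (subst (2 ≤_) (∣p∣≡1+∣p-x∣ v∈∁B) 2≤∣∁B∣)))
    with _ , f∈∁B-v , yf , _ ← y-lone
    = record
        { x = x ; y = y ; f = f ; core = ∁ B - v - f
        ; x≢y = λ { refl → nonadj⇒≢ G (proj₂ (complement-adj⁻ G yf)) xf refl }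
        ; xf = xf
        ; x-core = λ w∈ → lone-neighbour-in-complement G x-lone (proj₁ (x∈p-y⁻ _ w∈))
        ; y-core = lone-neighbour-in-complement G y-lone
        ; core≢f = λ w∈ → proj₂ (x∈p-y⁻ _ w∈)
        ; core⊆∁B = λ w∈ → p─q⊆p _ _ (p─q⊆p _ _ w∈)
        ; ∣∁B∣≡2+∣core∣ = trans (∣p∣≡1+∣p-x∣ v∈∁B) (cong suc (∣p∣≡1+∣p-x∣ f∈∁B-v))
        }
    where
    xf : Adj G x f
    xf = lone-neighbour-in-complement G x-lone f∈∁B-v

  -- 4-cycles

  data Traversal {A : Set} (a b c d : A) : A → A → A → A → Set where
    abcd : Traversal a b c d a b c d
    bcda : Traversal a b c d b c d a
    cdab : Traversal a b c d c d a b
    dabc : Traversal a b c d d a b c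
    adcb : Traversal a b c d a d c b
    badc : Traversal a b c d b a d c
    cbad : Traversal a b c d c b a d
    dcba : Traversal a b c d d c b a

  module _ {A : Set} (D : A → Set) (a b c d : A) where

    OppositePair : Set
    OppositePair = (D a × D c) ⊎ (D b × D d)

    EdgeAvoiding : Set
    EdgeAvoiding = ∃₂ λ p q → ∃₂ λ r s → Traversal a b c d p q r s × ¬ D p × ¬ D q

    CornerAvoiding : Set
    CornerAvoiding = ∃₂ λ p q → ∃₂ λ r s → Traversal a b c d p q r s × ¬ D p

  edge-meets-opposite-pair : ∀ {A : Set} {D : A → Set} {a b c d p q r s} →
    Traversal a b c d p q r s → OppositePair D a b c d → D p ⊎ D q
  edge-meets-opposite-pair abcd = [ inj₁ ∘ proj₁ , inj₂ ∘ proj₁ ]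
  edge-meets-opposite-pair bcda = [ inj₂ ∘ proj₂ , inj₁ ∘ proj₁ ]
  edge-meets-opposite-pair cdab = [ inj₁ ∘ proj₂ , inj₂ ∘ proj₂ ]
  edge-meets-opposite-pair dabc = [ inj₂ ∘ proj₁ , inj₁ ∘ proj₂ ]
  edge-meets-opposite-pair adcb = [ inj₁ ∘ proj₁ , inj₂ ∘ proj₂ ]
  edge-meets-opposite-pair badc = [ inj₂ ∘ proj₁ , inj₁ ∘ proj₁ ]
  edge-meets-opposite-pair cbad = [ inj₁ ∘ proj₂ , inj₂ ∘ proj₁ ]
  edge-meets-opposite-pair dcba = [ inj₂ ∘ proj₂ , inj₁ ∘ proj₂ ]

  module _ {A : Set} {D : A → Set} (D? : Decidable D) {a b c d : A} where

    private
      count : ℕ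
      count = length (filter D? (a ∷ b ∷ c ∷ d ∷ []))

      ones : ∀ {x} → Dec (D x) → ℕ
      ones D?x = if does D?x then 1 else 0

      length-filter-∷ : ∀ x xs → length (filter D? (x ∷ xs)) ≡ ones (D? x) + length (filter D? xs)
      length-filter-∷ x xs with does (D? x)
      ... | true  = refl
      ... | false = refl

      -- filter hides the tests at b, c, d behind the one at a, so a simultaneous
      -- with D? a | D? b | D? c | D? d only sees them after rewriting with count≡sum.
      count≡sum : count ≡ ones (D? a) + (ones (D? b) + (ones (D? c) + (ones (D? d) + 0)))
      count≡sum = trans (length-filter-∷ a _) (cong (ones (D? a) +_)
                  (trans (length-filter-∷ b _) (cong (ones (D? b) +_)
                  (trans (length-filter-∷ c _) (cong (ones (D? c) +_) (length-filter-∷ d _))))))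

    ¬opposite-pair⇒edge-avoiding : ¬ OppositePair D a b c d → EdgeAvoiding D a b c d
    ¬opposite-pair⇒edge-avoiding no-pair with D? a | D? b | D? c | D? d
    ... | yes Da | _      | yes Dc | _      = contradiction (inj₁ (Da , Dc)) no-pair
    ... | _      | yes Db | _      | yes Dd = contradiction (inj₂ (Db , Dd)) no-pair
    ... | no ¬a  | no ¬b  | _      | _      = _ , _ , _ , _ , abcd , ¬a , ¬b
    ... | _      | no ¬b  | no ¬c  | _      = _ , _ , _ , _ , bcda , ¬b , ¬c
    ... | _      | _      | no ¬c  | no ¬d  = _ , _ , _ , _ , cdab , ¬c , ¬d
    ... | no ¬a  | _      | _      | no ¬d  = _ , _ , _ , _ , dabc , ¬d , ¬a

    opposite-pair⇒2≤count : OppositePair D a b c d → 2 ≤ count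
    opposite-pair⇒2≤count (inj₁ (Da , Dc)) rewrite count≡sum with D? a | D? b | D? c | D? d
    ... | no ¬a | _     | _     | _     = contradiction Da ¬a
    ... | _     | _     | no ¬c | _     = contradiction Dc ¬c
    ... | yes _ | yes _ | yes _ | _     = s≤s (s≤s z≤n)
    ... | yes _ | no _  | yes _ | _     = s≤s (s≤s z≤n)
    opposite-pair⇒2≤count (inj₂ (Db , Dd)) rewrite count≡sum with D? a | D? b | D? c | D? d
    ... | _     | no ¬b | _     | _     = contradiction Db ¬b
    ... | _     | _     | _     | no ¬d = contradiction Dd ¬d
    ... | yes _ | yes _ | _     | yes _ = s≤s (s≤s z≤n)
    ... | no _  | yes _ | yes _ | yes _ = s≤s (s≤s z≤n)
    ... | no _  | yes _ | no _  | yes _ = s≤s (s≤s z≤n)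

    count≡2⇒opposite-pair : count ≡ 2 → ¬ (D a × D b) → ¬ (D b × D c) → ¬ (D c × D d) → ¬ (D d × D a) →
                            OppositePair D a b c d
    count≡2⇒opposite-pair count≡2 ¬ab ¬bc ¬cd ¬da rewrite count≡sum with D? a | D? b | D? c | D? d
    ... | yes Da | _      | yes Dc | _      = inj₁ (Da , Dc)
    ... | _      | yes Db | _      | yes Dd = inj₂ (Db , Dd)
    ... | yes Da | yes Db | _      | _      = contradiction (Da , Db) ¬ab
    ... | _      | yes Db | yes Dc | _      = contradiction (Db , Dc) ¬bc
    ... | _      | _      | yes Dc | yes Dd = contradiction (Dc , Dd) ¬cd
    ... | yes Da | _      | _      | yes Dd = contradiction (Dd , Da) ¬da
    ... | no _   | no _   | no _   | no _   with () ← count≡2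
    ... | yes _  | no _   | no _   | no _   with () ← count≡2
    ... | no _   | yes _  | no _   | no _   with () ← count≡2
    ... | no _   | no _   | yes _  | no _   with () ← count≡2
    ... | no _   | no _   | no _   | yes _  with () ← count≡2

    count≡3⇒opposite-pair : count ≡ 3 → OppositePair D a b c d
    count≡3⇒opposite-pair count≡3 rewrite count≡sum with D? a | D? b | D? c | D? d
    ... | yes Da | _      | yes Dc | _      = inj₁ (Da , Dc)
    ... | _      | yes Db | _      | yes Dd = inj₂ (Db , Dd)
    ... | no _   | no _   | no _   | no _   with () ← count≡3
    ... | no _   | yes _  | no _   | no _   with () ← count≡3
    ... | no _   | no _   | no _   | yes _  with () ← count≡3
    ... | yes _  | no _   | no _   | no _   with () ← count≡3
    ... | yes _  | yes _  | no _   | no _   with () ← count≡3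
    ... | yes _  | no _   | no _   | yes _  with () ← count≡3
    ... | no _   | no _   | yes _  | no _   with () ← count≡3
    ... | no _   | yes _  | yes _  | no _   with () ← count≡3
    ... | no _   | no _   | yes _  | yes _  with () ← count≡3

    count≢4⇒corner-avoiding : count ≢ 4 → CornerAvoiding D a b c d
    count≢4⇒corner-avoiding count≢4 rewrite count≡sum with D? a | D? b | D? c | D? d
    ... | no ¬a  | _      | _      | _      = _ , _ , _ , _ , abcd , ¬a
    ... | _      | no ¬b  | _      | _      = _ , _ , _ , _ , bcda , ¬b
    ... | _      | _      | no ¬c  | _      = _ , _ , _ , _ , cdab , ¬c
    ... | _      | _      | _      | no ¬d  = _ , _ , _ , _ , dabc , ¬d
    ... | yes _  | yes _  | yes _  | yes _  = contradiction refl count≢4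

  record Square (G : Graph n) (p q r s : Fin n) : Set where
    field
      p≢r : p ≢ r
      q≢s : q ≢ s
      pq  : Adj G p q
      qr  : Adj G q r
      rs  : Adj G r s
      sp  : Adj G s p

  record InducedSquare (G : Graph n) (p q r s : Fin n) : Set where
    field
      square : Square G p q r s
      ¬pr    : adj G p r ≡ false
      ¬qs    : adj G q s ≡ false
    open Square square public

  module _ {G : Graph n} where

    rotate : ∀ {p q r s} → Square G p q r s → Square G q r s p
    rotate sq = record { p≢r = q≢s ; q≢s = ≢-sym p≢r ; pq = qr ; qr = rs ; rs = sp ; sp = pq }
      where open Square sq

    reflect : ∀ {p q r s} → Square G p q r s → Square G p s r q
    reflect sq = record { p≢r = p≢r ; q≢s = ≢-sym q≢s ; pq = adj-sym G sp ; qr = adj-sym G rs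
                        ; rs = adj-sym G qr ; sp = adj-sym G pq }
      where open Square sq

    rotate-induced : ∀ {p q r s} → InducedSquare G p q r s → InducedSquare G q r s p
    rotate-induced isq = record { square = rotate square ; ¬pr = ¬qs ; ¬qs = trans (Graph.sym G _ _) ¬pr }
      where open InducedSquare isq

    reflect-induced : ∀ {p q r s} → InducedSquare G p q r s → InducedSquare G p s r q
    reflect-induced isq = record { square = reflect square ; ¬pr = ¬pr ; ¬qs = trans (Graph.sym G _ _) ¬qs }
      where open InducedSquare isq

    traverse : ∀ {a b c d p q r s} → InducedSquare G a b c d → Traversal a b c d p q r s →
               InducedSquare G p q r s
    traverse isq abcd = isq
    traverse isq bcda = rotate-induced isq
    traverse isq cdab = rotate-induced (rotate-induced isq)
    traverse isq dabc = rotate-induced (rotate-induced (rotate-induced isq))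
    traverse isq adcb = reflect-induced isq
    traverse isq badc = reflect-induced (rotate-induced isq)
    traverse isq cbad = reflect-induced (rotate-induced (rotate-induced isq))
    traverse isq dcba = reflect-induced (rotate-induced (rotate-induced (rotate-induced isq)))

    induced-square : ∀ {a b c d} → InducedC4 G a b c d → InducedSquare G a b c d
    induced-square (_ , a≢c , _ , _ , b≢d , _ , ab , bc , cd , da , ¬ac , ¬bd) =
      record { square = record { p≢r = a≢c ; q≢s = b≢d ; pq = ab ; qr = bc ; rs = cd ; sp = da }
             ; ¬pr = ¬ac ; ¬qs = ¬bd }

    four-cycle : ∀ {p q r s} → Square G p q r s → Cycle G
    four-cycle {p} {q} {r} {s} sq = record
      { len    = 1
      ; vtx    = Vec.lookup vertices
      ; inj    = λ {i} {j} → lookup-injective distinct i j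
      ; consec = λ { zero → pq ; (suc zero) → qr ; (suc (suc zero)) → rs }
      ; close  = sp
      }
      where
      open Square sq
      vertices : Vec (Fin n) 4
      vertices = p ∷ q ∷ r ∷ s ∷ []
      distinct : Unique vertices
      distinct = (adj⇒≢ G pq ∷ p≢r ∷ ≢-sym (adj⇒≢ G sp) ∷ [])
               ∷ (adj⇒≢ G qr ∷ q≢s ∷ [])
               ∷ (adj⇒≢ G rs ∷ [])
               ∷ []
               ∷ []

    four-cycle-edge : ∀ {p q r s u v} (sq : Square G p q r s) → UsesEdge (four-cycle sq) u v →
                      ∃₂ (Traversal p q r s u v)
    four-cycle-edge _ (inj₁ (inj₁ (zero , refl , refl)))             = _ , _ , abcd
    four-cycle-edge _ (inj₁ (inj₁ (suc zero , refl , refl)))         = _ , _ , bcda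
    four-cycle-edge _ (inj₁ (inj₁ (suc (suc zero) , refl , refl)))   = _ , _ , cdab
    four-cycle-edge _ (inj₁ (inj₂ (refl , refl)))                    = _ , _ , dabc
    four-cycle-edge _ (inj₂ (inj₁ (zero , refl , refl)))             = _ , _ , badc
    four-cycle-edge _ (inj₂ (inj₁ (suc zero , refl , refl)))         = _ , _ , cbad
    four-cycle-edge _ (inj₂ (inj₁ (suc (suc zero) , refl , refl)))   = _ , _ , dcba
    four-cycle-edge _ (inj₂ (inj₂ (refl , refl)))                    = _ , _ , adcb

  -- Graphs with a unique cycle

  UniqueCycle : Graph n → Set
  UniqueCycle {n} G = (C D : Cycle G) (u v : Fin n) → UsesEdge C u v → UsesEdge D u v

  module _ {G : Graph n} (unique : UniqueCycle G) where

    edge-on-every-square : ∀ {p q r s a b c d} → Square G p q r s → Square G a b c d →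
                           ∃₂ (Traversal a b c d p q)
    edge-on-every-square sq sq′ =
      four-cycle-edge sq′ (unique (four-cycle sq) (four-cycle sq′) _ _ (inj₁ (inj₁ (zero , refl , refl))))

    no-K₂,₃ : ∀ {x y p q r} → x ≢ y → p ≢ q → p ≢ r → q ≢ r →
              Adj G x p → Adj G x q → Adj G x r → Adj G y p → Adj G y q → Adj G y r → ⊥
    -- The edge q x of the square q x p y would have to lie on the square x p y r.
    no-K₂,₃ {x} {y} {p} {q} {r} x≢y p≢q p≢r q≢r xp xq xr yp yq yr =
      qx-not-on-xpyr (proj₂ (proj₂ (edge-on-every-square qxpy xpyr)))
      where
      qxpy : Square G q x p y
      qxpy = record { p≢r = ≢-sym p≢q ; q≢s = x≢y ; pq = adj-sym G xq ; qr = xp ; rs = adj-sym G yp ; sp = yq }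
      xpyr : Square G x p y r
      xpyr = record { p≢r = x≢y ; q≢s = p≢r ; pq = xp ; qr = adj-sym G yp ; rs = yr ; sp = adj-sym G xr }
      qx-not-on-xpyr : ∀ {s t} → Traversal x p y r q x s t → ⊥
      qx-not-on-xpyr abcd = adj⇒≢ G xp refl
      qx-not-on-xpyr bcda = x≢y refl
      qx-not-on-xpyr cdab = adj⇒≢ G xr refl
      qx-not-on-xpyr dabc = q≢r refl
      qx-not-on-xpyr adcb = adj⇒≢ G xr refl
      qx-not-on-xpyr badc = p≢q refl
      qx-not-on-xpyr cbad = adj⇒≢ G xp refl
      qx-not-on-xpyr dcba = x≢y refl

    outer-neighbour-misses-opposite : ∀ {p q r s p′} → InducedSquare G p q r s →
      Adj G p p′ → p′ ≢ q → p′ ≢ s → p′ ≢ r × adj G r p′ ≡ false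
    outer-neighbour-misses-opposite isq pp′ p′≢q p′≢s =
      ≢-sym (nonadj⇒≢ G ¬pr pp′) ,
      ¬-not (no-K₂,₃ p≢r q≢s (≢-sym p′≢q) (≢-sym p′≢s) pq (adj-sym G sp) pp′ (adj-sym G qr) rs)
      where open InducedSquare isq

    module Forcing {p q r s p′ : Fin n} (isq : InducedSquare G p q r s)
                   (pp′ : Adj G p p′) (p′≢q : p′ ≢ q) (p′≢s : p′ ≢ s) {B : Subset n}
                   (blue-outside : ∀ {w} → w ≢ p′ → w ≢ q → w ≢ r → w ≢ s → Blue (complement G) B w)
                   where
      open InducedSquare isq

      private
        p′≢r : p′ ≢ r
        p′≢r = proj₁ (outer-neighbour-misses-opposite isq pp′ p′≢q p′≢s)
        ¬rp′ : adj G r p′ ≡ false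
        ¬rp′ = proj₂ (outer-neighbour-misses-opposite isq pp′ p′≢q p′≢s)

      blue-r : Blue (complement G) B r
      blue-r = force (blue-outside (adj⇒≢ G pp′) (adj⇒≢ G pq) p≢r (≢-sym (adj⇒≢ G sp)))
                     (complement-adj⁺ G p≢r ¬pr)
                     λ w pw w≢r → let ¬pw = proj₂ (complement-adj⁻ G pw) in
                       blue-outside (nonadj⇒≢ G ¬pw pp′) (nonadj⇒≢ G ¬pw pq) w≢r (nonadj⇒≢ G ¬pw (adj-sym G sp))

      blue-p′ : Blue (complement G) B p′
      blue-p′ = force blue-r (complement-adj⁺ G (≢-sym p′≢r) ¬rp′)
                      λ w rw w≢p′ → let r≢w , ¬rw = complement-adj⁻ G rw in
                        blue-outside w≢p′ (nonadj⇒≢ G ¬rw (adj-sym G qr)) (≢-sym r≢w) (nonadj⇒≢ G ¬rw rs)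

      blue-unless-q-or-s : ∀ {w} → w ≢ q → w ≢ s → Blue (complement G) B w
      blue-unless-q-or-s {w} w≢q w≢s with w ≟ p′ | w ≟ r
      ... | yes refl | _        = blue-p′
      ... | no _     | yes refl = blue-r
      ... | no w≢p′  | no w≢r   = blue-outside w≢p′ w≢q w≢r w≢s

      blue-s-from-outer-neighbour-of-q : ∀ {q′} → Adj G q q′ → q′ ≢ r → q′ ≢ p → Blue (complement G) B s
      blue-s-from-outer-neighbour-of-q {q′} qq′ q′≢r q′≢p =
        force (blue-unless-q-or-s (≢-sym (adj⇒≢ G qq′)) q′≢s)
              (complement-adj⁺ G q′≢s (trans (Graph.sym G q′ s) ¬sq′))
              λ w q′w w≢s → blue-unless-q-or-s (nonadj⇒≢ G (proj₂ (complement-adj⁻ G q′w)) (adj-sym G qq′)) w≢s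
        where
        q′≢s : q′ ≢ s
        q′≢s = proj₁ (outer-neighbour-misses-opposite (rotate-induced isq) qq′ q′≢r q′≢p)
        ¬sq′ : adj G s q′ ≡ false
        ¬sq′ = proj₂ (outer-neighbour-misses-opposite (rotate-induced isq) qq′ q′≢r q′≢p)

      zero-forcing-once-s-blue : Blue (complement G) B s → IsZeroForcingSet (complement G) B
      zero-forcing-once-s-blue blue-s w with w ≟ q | w ≟ s
      ... | yes refl | _        = blue-q
        where
        blue-q : Blue (complement G) B q
        blue-q = force blue-s (complement-adj⁺ G (≢-sym q≢s) (trans (Graph.sym G s q) ¬qs))
                       λ w sw w≢q → blue-unless-q-or-s w≢q (≢-sym (proj₁ (complement-adj⁻ G sw)))
      ... | no _     | yes refl = blue-s
      ... | no w≢q   | no w≢s   = blue-unless-q-or-s w≢q w≢s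

    module _ {p q r s} (isq : InducedSquare G p q r s) where
      open InducedSquare isq

      outer-neighbour : deg G p ≢ 2 → ∃ λ p′ → Adj G p p′ × p′ ≢ q × p′ ≢ s
      outer-neighbour = deg≢2⇒third-neighbour G pq (adj-sym G sp) q≢s

      zero-forcing-set-of-size-n∸3 : deg G p ≢ 2 →
        Σ (Subset n) λ B → IsZeroForcingSet (complement G) B × ∣ B ∣ ≡ n ∸ 3
      zero-forcing-set-of-size-n∸3 deg-p≢2 with p′ , pp′ , p′≢q , p′≢s ← outer-neighbour deg-p≢2 =
        let B : Subset n
            B = ⊤ - p′ - q - r
            blue-outside : ∀ {w} → w ≢ p′ → w ≢ q → w ≢ r → Blue (complement G) B w
            blue-outside w≢p′ w≢q w≢r =
              init (x∈p∧x≢y⇒x∈p-y (x∈p∧x≢y⇒x∈p-y (x∈p∧x≢y⇒x∈p-y ∈⊤ w≢p′) w≢q) w≢r)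
            open Forcing isq pp′ p′≢q p′≢s (λ w≢p′ w≢q w≢r _ → blue-outside w≢p′ w≢q w≢r)
        in  B ,
            zero-forcing-once-s-blue (blue-outside (≢-sym p′≢s) (≢-sym q≢s) (≢-sym (adj⇒≢ G rs))) ,
            ∣⊤-x-y-z∣≡n∸3 p′≢q (proj₁ (outer-neighbour-misses-opposite isq pp′ p′≢q p′≢s)) (adj⇒≢ G qr)

      zero-forcing-set-of-size-n∸4 : deg G p ≢ 2 → deg G q ≢ 2 →
        Σ (Subset n) λ B → IsZeroForcingSet (complement G) B × ∣ B ∣ ≡ n ∸ 4
      zero-forcing-set-of-size-n∸4 deg-p≢2 deg-q≢2
        with p′ , pp′ , p′≢q , p′≢s ← outer-neighbour deg-p≢2
        with q′ , qq′ , q′≢r , q′≢p ← deg≢2⇒third-neighbour G qr (adj-sym G pq) (≢-sym p≢r) deg-q≢2 =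
        let B : Subset n
            B = ⊤ - p′ - q - r - s
            blue-outside : ∀ {w} → w ≢ p′ → w ≢ q → w ≢ r → w ≢ s → Blue (complement G) B w
            blue-outside w≢p′ w≢q w≢r w≢s =
              init (x∈p∧x≢y⇒x∈p-y (x∈p∧x≢y⇒x∈p-y (x∈p∧x≢y⇒x∈p-y (x∈p∧x≢y⇒x∈p-y ∈⊤ w≢p′) w≢q) w≢r) w≢s)
            open Forcing isq pp′ p′≢q p′≢s blue-outside
        in  B ,
            zero-forcing-once-s-blue (blue-s-from-outer-neighbour-of-q qq′ q′≢r q′≢p) ,
            ∣⊤-w-x-y-z∣≡n∸4 p′≢q (proj₁ (outer-neighbour-misses-opposite isq pp′ p′≢q p′≢s)) p′≢s
                             (adj⇒≢ G qr) q≢s (adj⇒≢ G rs)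

    five-white-vertices-impossible : ∀ {B} → IsZeroForcingSet (complement G) B → ¬ 4 < ∣ ∁ B ∣
    five-white-vertices-impossible zfs 5≤∣∁B∣ =
      let open CommonNeighbours (common-neighbours G zfs (≤-trans (s≤s (s≤s z≤n)) 5≤∣∁B∣))
          g , h , k , g∈ , h∈ , k∈ , g≢h , g≢k , h≢k =
            three-elements (s≤s⁻¹ (s≤s⁻¹ (subst (5 ≤_) ∣∁B∣≡2+∣core∣ 5≤∣∁B∣)))
      in  no-K₂,₃ x≢y g≢h g≢k h≢k (x-core g∈) (x-core h∈) (x-core k∈) (y-core g∈) (y-core h∈) (y-core k∈)

    degree-2-on-square : ∀ {a b c d x g y h} → InducedSquare G a b c d →
      OppositePair (λ v → deg G v ≡ 2) a b c d → Square G x g y h → deg G x ≢ 2 → deg G g ≡ 2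
    degree-2-on-square isq deg-2-pair sq deg-x≢2
      with _ , _ , xg-on-square ← edge-on-every-square sq (InducedSquare.square isq)
      = [ (λ deg-x≡2 → contradiction deg-x≡2 deg-x≢2) , id ] (edge-meets-opposite-pair xg-on-square deg-2-pair)

    module _ {a b c d B} (isq : InducedSquare G a b c d) (deg-2-pair : OppositePair (λ v → deg G v ≡ 2) a b c d)
             (zfs : IsZeroForcingSet (complement G) B) (cn : CommonNeighbours G B) where
      open CommonNeighbours cn

      private
        x-g-y-h : ∀ {g h} → g ∈ core → h ∈ core → g ≢ h → Square G x g y h
        x-g-y-h g∈ h∈ g≢h = record { p≢r = x≢y ; q≢s = g≢h ; pq = x-core g∈ ; qr = adj-sym G (y-core g∈)
                                   ; rs = y-core h∈ ; sp = adj-sym G (x-core h∈) }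

        deg-x≢2 : ∀ {g h} → g ∈ core → h ∈ core → g ≢ h → deg G x ≢ 2
        deg-x≢2 g∈ h∈ g≢h =
          third-neighbour⇒deg≢2 G (x-core g∈) (x-core h∈) g≢h xf (≢-sym (core≢f g∈)) (≢-sym (core≢f h∈))

      core-twins : ∀ {g h} → g ∈ core → h ∈ core → g ≢ h → ∀ {w} → Adj G g w → Adj G h w
      core-twins g∈ h∈ g≢h gw
        with deg≡2⇒neighbour-is-one-of G (adj-sym G (x-core g∈)) (adj-sym G (y-core g∈)) x≢y
               (degree-2-on-square isq deg-2-pair (x-g-y-h g∈ h∈ g≢h) (deg-x≢2 g∈ h∈ g≢h)) gw
      ... | inj₁ refl = adj-sym G (x-core h∈)
      ... | inj₂ refl = adj-sym G (y-core h∈)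

      two-core-vertices-impossible : ¬ 2 ≤ ∣ core ∣
      two-core-vertices-impossible 2≤∣core∣
        with g , h , g∈ , h∈ , g≢h , _ ← two-elements 2≤∣core∣
        with nonempty? (core - g - h)
      ... | yes (k , k∈core-g-h) =
        let k∈core-g , k≢h = x∈p-y⁻ _ k∈core-g-h
            k∈core , k≢g   = x∈p-y⁻ _ k∈core-g
        in  no-K₂,₃ x≢y g≢h (≢-sym k≢g) (≢-sym k≢h)
                    (x-core g∈) (x-core h∈) (x-core k∈core) (y-core g∈) (y-core h∈) (y-core k∈core)
      ... | no core-g-h-empty =
        fort-meets-zero-forcing-set (complement G) zfs
          (twins-fort G (core-twins g∈ h∈ g≢h) (core-twins h∈ g∈ (≢-sym g≢h))
                      (Empty[p-x-y]⇒x⊎y core-g-h-empty) g∈ h∈ g≢h)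
          (_ , g∈) core⊆∁B

    four-white-vertices-impossible : ∀ {a b c d B} → InducedSquare G a b c d →
      OppositePair (λ v → deg G v ≡ 2) a b c d → IsZeroForcingSet (complement G) B → ¬ 3 < ∣ ∁ B ∣
    four-white-vertices-impossible isq deg-2-pair zfs 4≤∣∁B∣ =
      two-core-vertices-impossible isq deg-2-pair zfs cn (s≤s⁻¹ (s≤s⁻¹ (subst (4 ≤_) ∣∁B∣≡2+∣core∣ 4≤∣∁B∣)))
      where
      cn : CommonNeighbours G _
      cn = common-neighbours G zfs (≤-trans (s≤s (s≤s z≤n)) 4≤∣∁B∣)
      open CommonNeighbours cn

    Z≡n∸4 : ∀ {a b c d} → InducedSquare G a b c d → EdgeAvoiding (λ v → deg G v ≡ 2) a b c d →
            ZeroForcingNumberIs (complement G) (n ∸ 4)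
    Z≡n∸4 isq (_ , _ , _ , _ , pqrs , deg-p≢2 , deg-q≢2) =
      zero-forcing-set-of-size-n∸4 (traverse isq pqrs) deg-p≢2 deg-q≢2 ,
      λ B zfs → ∣∁p∣≤k⇒n∸k≤∣p∣ B (≮⇒≥ (five-white-vertices-impossible zfs))

    Z≡n∸3 : ∀ {a b c d} → InducedSquare G a b c d → OppositePair (λ v → deg G v ≡ 2) a b c d →
            CornerAvoiding (λ v → deg G v ≡ 2) a b c d → ZeroForcingNumberIs (complement G) (n ∸ 3)
    Z≡n∸3 isq deg-2-pair (_ , _ , _ , _ , pqrs , deg-p≢2) =
      zero-forcing-set-of-size-n∸3 (traverse isq pqrs) deg-p≢2 ,
      λ B zfs → ∣∁p∣≤k⇒n∸k≤∣p∣ B (≮⇒≥ (four-white-vertices-impossible isq deg-2-pair zfs))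

open import Data.Nat using (ℕ; _≤_; _∸_; s≤s; _≟_)
open import Data.Nat.Properties using (≤-trans)
open import Data.Fin using (Fin)
open import Data.Bool using (true; false; not)
open import Data.Bool.Properties using (not-¬)
open import Data.List using (_∷_; [])
open import Data.List.Membership.Propositional using (_∈_)
open import Data.List.Relation.Unary.Any using (here; there)
open import Data.Product using (_×_; _,_)
open import Data.Sum using ([_,_])
open import Function using (case_of_)
open import Relation.Nullary using (¬_; contradiction)
open import Relation.Unary using (Decidable)
open import Relation.Binary.PropositionalEquality using (_≡_; _≢_; refl; sym; trans)

theorem3p9 : ∀ {n} (G : Graph n) → 5 ≤ n → Unicyclic G →
    (a b c d : Fin n) → InducedC4 G a b c d →
    (numDeg2 G a b c d ≤ 1 → ZeroForcingNumberIs (complement G) (n ∸ 4))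
    × (numDeg2 G a b c d ≡ 2 →
        (∀ x y → x ∈ a ∷ b ∷ c ∷ d ∷ [] → y ∈ a ∷ b ∷ c ∷ d ∷ [] → x ≢ y →
          deg G x ≡ 2 → deg G y ≡ 2 → adj G x y ≡ true) →
        ZeroForcingNumberIs (complement G) (n ∸ 4))
    × (numDeg2 G a b c d ≡ 2 →
        (∀ x y → x ∈ a ∷ b ∷ c ∷ d ∷ [] → y ∈ a ∷ b ∷ c ∷ d ∷ [] → x ≢ y →
          deg G x ≡ 2 → deg G y ≡ 2 → adj G x y ≡ false) →
        ZeroForcingNumberIs (complement G) (n ∸ 3))
    × (numDeg2 G a b c d ≡ 3 → ZeroForcingNumberIs (complement G) (n ∸ 3))
theorem3p9 G _ (_ , _ , unique) a b c d ic =
    (λ count≤1 → Z≡n∸4 unique isq (¬opposite-pair⇒edge-avoiding deg≟2 λ pair →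
       contradiction (≤-trans (opposite-pair⇒2≤count deg≟2 pair) count≤1) λ { (s≤s ()) }))
  , (λ _ adjacent → Z≡n∸4 unique isq (¬opposite-pair⇒edge-avoiding deg≟2
       [ not-both-degree-2 (adjacent a c a∈ c∈ p≢r) ¬pr , not-both-degree-2 (adjacent b d b∈ d∈ q≢s) ¬qs ]))
  , (λ count≡2 nonadjacent → Z≡n∸3 unique isq
       (count≡2⇒opposite-pair deg≟2 count≡2
          (not-both-degree-2 (nonadjacent a b a∈ b∈ (adj⇒≢ G pq)) pq)
          (not-both-degree-2 (nonadjacent b c b∈ c∈ (adj⇒≢ G qr)) qr)
          (not-both-degree-2 (nonadjacent c d c∈ d∈ (adj⇒≢ G rs)) rs)
          (not-both-degree-2 (nonadjacent d a d∈ a∈ (adj⇒≢ G sp)) sp))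
       (count≢4⇒corner-avoiding deg≟2 λ count≡4 → case trans (sym count≡2) count≡4 of λ ()))
  , (λ count≡3 → Z≡n∸3 unique isq (count≡3⇒opposite-pair deg≟2 count≡3)
       (count≢4⇒corner-avoiding deg≟2 λ count≡4 → case trans (sym count≡3) count≡4 of λ ()))
  where
  isq : InducedSquare G a b c d
  isq = induced-square ic
  open InducedSquare isq

  deg≟2 : Decidable (λ x → deg G x ≡ 2)
  deg≟2 x = deg G x ≟ 2

  a∈ : a ∈ a ∷ b ∷ c ∷ d ∷ []
  a∈ = here refl
  b∈ : b ∈ a ∷ b ∷ c ∷ d ∷ []
  b∈ = there (here refl)
  c∈ : c ∈ a ∷ b ∷ c ∷ d ∷ []
  c∈ = there (there (here refl))
  d∈ : d ∈ a ∷ b ∷ c ∷ d ∷ []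
  d∈ = there (there (there (here refl)))

  not-both-degree-2 : ∀ {x y t} → (deg G x ≡ 2 → deg G y ≡ 2 → adj G x y ≡ t) → adj G x y ≡ not t →
                      ¬ (deg G x ≡ 2 × deg G y ≡ 2)
  not-both-degree-2 forced actual (deg-x≡2 , deg-y≡2) = not-¬ (forced deg-x≡2 deg-y≡2) actual
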